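{- Let $p\geq 5$ be a prime and $n\geq 1$ an integer. Then \[ \nu_p\!\left(H(p^2n)-\frac{H(n)}{p^2}\right)\geq 1. \]
   Context: $H(N)=1+\frac12+\cdots+\frac1N$ is the $N$-th harmonic number; $\nu_p$ denotes the $p$-adic valuation on $\mathbb{Q}$, with $\nu_p(0)=\infty$. -}

module Defs where

open import Data.Nat as ℕ using (ℕ; zero; suc; _^_)
open import Data.Integer as ℤ using (ℤ; +_)
open import Data.Integer.Divisibility as ℤD using ()
open import Data.Rational using (ℚ; _+_; _*_; _-_; _/_; 1ℚ; 0ℚ)
open import Data.Nat.Properties using (m^n≢0)
open import Data.Nat.Primality using (Prime; prime⇒nonZero)
open import Data.Product using (Σ; _×_)
open import Relation.Nullary using (¬_)
open import Relation.Binary.PropositionalEquality using (_≡_; _≢_)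

H : ℕ → ℚ
H zero    = 0ℚ
H (suc n) = H n + (+ 1 / suc n)

-- ν_p(x) ≥ k  (for x : ℚ, k : ℕ):  x = p^k · (a / b) with integers a, b,
-- b ≠ 0 and p ∤ b.  This holds trivially for x = 0 (ν_p(0) = ∞).
νAtLeast : (p : ℕ) → ℚ → ℕ → Set
νAtLeast p x k =
  Σ ℤ λ a → Σ ℤ λ b →
    (b ≢ + 0) × (¬ ((+ p) ℤD.∣ b)) × (x * (b / 1) ≡ (+ (p ^ k) / 1) * (a / 1))

divPrimePow : (p : ℕ) → Prime p → ℕ → ℚ → ℚ
divPrimePow p pp k x = x * (+ 1 / (p ^ k)) {{m^n≢0 p k {{prime⇒nonZero pp}}}}

-- Cut the range 1..p²n into blocks of p consecutive integers.  The last
-- entry of each block is a multiple of p, and these entries contribute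
-- H(pn)/p; cutting again, H(p²n) - H(n)/p² is a sum of block sums
-- B(m) = Σ_{0<r<p} 1/(mp+r), some of them divided by p.  So it suffices
-- that ν_p(B(m)) ≥ 2, a Wolstenholme-type congruence.  Expanding
-- 1/(mp+r) = 1/r - mp/r² + O(p²) gives B(m) ≡ H(p-1) - mp·Q (mod p²) with
-- Q = Σ_{0<r<p} 1/r², pairing r with p-r gives 2H(p-1) ≡ -pQ (mod p²),
-- and Q ≡ 0 (mod p): with T = Σ_{r≤(p-1)/2} 1/r², pairing again gives
-- Q ≡ 2T, while the even r contribute exactly T/4 and pair off with the odd
-- ones, so Q ≡ T/2; hence 3Q ≡ 0, and p ∤ 3.

module Submission where

open import Data.Nat as ℕ using (ℕ; zero; suc; _∸_; _^_; _≤_; _<_; _≥_; s≤s; z≤n)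
import Data.Nat.Properties as ℕP
import Data.Nat.Divisibility as ℕD
open import Data.Nat.Primality using (Prime; euclidsLemma; prime⇒irreducible; prime⇒nonTrivial)
open import Data.Integer as ℤ using (ℤ; +_)
import Data.Integer.Properties as ℤP
import Data.Integer.Divisibility as ℤD
open import Data.Rational using (ℚ; 0ℚ; 1ℚ; _+_; _*_; _-_; -_; _/_; toℚᵘ)
import Data.Rational.Properties as ℚP
import Data.Rational.Unnormalised as ℚᵘ
import Data.Rational.Unnormalised.Properties as ℚᵘP
open import Data.Rational.Solver using (module +-*-Solver)
open import Algebra.Properties.CommutativeSemigroup ℕP.+-commutativeSemigroup using () renaming (interchange to +-interchange)
open import Data.Product using (∃-syntax; _,_)
open import Data.Sum using (_⊎_; inj₁; inj₂)
open import Function using (_∘_)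
open import Relation.Nullary using (¬_; contradiction)
open import Relation.Binary.PropositionalEquality
open ≡-Reasoning
open +-*-Solver

open import Defs

∑ : ℕ → (ℕ → ℚ) → ℚ
∑ zero    f = 0ℚ
∑ (suc n) f = ∑ n f + f n

∑-cong : ∀ n {f g} → (∀ i → i < n → f i ≡ g i) → ∑ n f ≡ ∑ n g
∑-cong zero    f≡g = refl
∑-cong (suc n) f≡g =
  cong₂ _+_ (∑-cong n (λ i i<n → f≡g i (ℕP.m<n⇒m<1+n i<n))) (f≡g n (ℕP.n<1+n n))

∑-+ : ∀ n f g → ∑ n (λ i → f i + g i) ≡ ∑ n f + ∑ n g
∑-+ zero    f g = refl
∑-+ (suc n) f g = trans (cong (_+ (f n + g n)) (∑-+ n f g))
  (solve 4 (λ a b c d → (a :+ b) :+ (c :+ d) := (a :+ c) :+ (b :+ d)) refl (∑ n f) (∑ n g) (f n) (g n))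

∑-- : ∀ n f g → ∑ n (λ i → f i - g i) ≡ ∑ n f - ∑ n g
∑-- zero    f g = refl
∑-- (suc n) f g = trans (cong (_+ (f n - g n)) (∑-- n f g))
  (solve 4 (λ a b c d → (a :- b) :+ (c :- d) := (a :+ c) :- (b :+ d)) refl (∑ n f) (∑ n g) (f n) (g n))

∑-* : ∀ n c f → ∑ n (λ i → c * f i) ≡ c * ∑ n f
∑-* zero    c f = solve 1 (λ c → con 0ℚ := c :* con 0ℚ) refl c
∑-* (suc n) c f = trans (cong (_+ (c * f n)) (∑-* n c f))
  (solve 3 (λ c a b → c :* a :+ c :* b := c :* (a :+ b)) refl c (∑ n f) (f n))

∑-split : ∀ m n f → ∑ (m ℕ.+ n) f ≡ ∑ m f + ∑ n (λ i → f (m ℕ.+ i))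
∑-split m zero f = trans (cong (λ k → ∑ k f) (ℕP.+-identityʳ m))
  (solve 1 (λ a → a := a :+ con 0ℚ) refl (∑ m f))
∑-split m (suc n) f = begin
  ∑ (m ℕ.+ suc n) f                                       ≡⟨ cong (λ k → ∑ k f) (ℕP.+-suc m n) ⟩
  ∑ (m ℕ.+ n) f + f (m ℕ.+ n)                             ≡⟨ cong (_+ f (m ℕ.+ n)) (∑-split m n f) ⟩
  ∑ m f + ∑ n (λ i → f (m ℕ.+ i)) + f (m ℕ.+ n)           ≡⟨ solve 3 (λ a b c → (a :+ b) :+ c := a :+ (b :+ c)) refl
                                                               (∑ m f) (∑ n (λ i → f (m ℕ.+ i))) (f (m ℕ.+ n)) ⟩
  ∑ m f + (∑ n (λ i → f (m ℕ.+ i)) + f (m ℕ.+ n))         ∎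

∑-uncons : ∀ n f → ∑ (suc n) f ≡ f 0 + ∑ n (f ∘ suc)
∑-uncons zero    f = solve 1 (λ a → con 0ℚ :+ a := a :+ con 0ℚ) refl (f 0)
∑-uncons (suc n) f = trans (cong (_+ f (suc n)) (∑-uncons n f))
  (solve 3 (λ a b c → (a :+ b) :+ c := a :+ (b :+ c)) refl (f 0) (∑ n (f ∘ suc)) (f (suc n)))

∑-reverse : ∀ n f → ∑ n f ≡ ∑ n (λ i → f (n ∸ suc i))
∑-reverse zero    f = refl
∑-reverse (suc n) f = begin
  ∑ n f + f n                                  ≡⟨ cong (_+ f n) (∑-reverse n f) ⟩
  ∑ n (λ i → f (n ∸ suc i)) + f n              ≡⟨ solve 2 (λ a b → a :+ b := b :+ a) refl (∑ n (λ i → f (n ∸ suc i))) (f n) ⟩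
  f n + ∑ n (λ i → f (n ∸ suc i))              ≡⟨ ∑-uncons n (λ i → f (suc n ∸ suc i)) ⟨
  ∑ (suc n) (λ i → f (suc n ∸ suc i))          ∎

∑-evenOdd : ∀ n f → ∑ (n ℕ.+ n) f ≡ ∑ n (λ i → f (i ℕ.+ i)) + ∑ n (λ i → f (suc (i ℕ.+ i)))
∑-evenOdd zero    f = refl
∑-evenOdd (suc n) f = begin
  ∑ (suc n ℕ.+ suc n) f                       ≡⟨ cong (λ k → ∑ (suc k) f) (ℕP.+-suc n n) ⟩
  ∑ (n ℕ.+ n) f + f (n ℕ.+ n) + f (suc (n ℕ.+ n)) ≡⟨ cong (λ s → s + f (n ℕ.+ n) + f (suc (n ℕ.+ n))) (∑-evenOdd n f) ⟩
  E + O + f (n ℕ.+ n) + f (suc (n ℕ.+ n))     ≡⟨ solve 4 (λ a b c d → a :+ b :+ c :+ d := (a :+ c) :+ (b :+ d)) refl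
                                                     E O (f (n ℕ.+ n)) (f (suc (n ℕ.+ n))) ⟩
  (E + f (n ℕ.+ n)) + (O + f (suc (n ℕ.+ n)))  ∎
  where
  E = ∑ n (λ i → f (i ℕ.+ i))
  O = ∑ n (λ i → f (suc (i ℕ.+ i)))

∑-blocks : ∀ m n f → ∑ (m ℕ.* n) f ≡ ∑ m (λ i → ∑ n (λ r → f (i ℕ.* n ℕ.+ r)))
∑-blocks zero    n f = refl
∑-blocks (suc m) n f = begin
  ∑ (n ℕ.+ m ℕ.* n) f                                     ≡⟨ cong (λ k → ∑ k f) (ℕP.+-comm n (m ℕ.* n)) ⟩
  ∑ (m ℕ.* n ℕ.+ n) f                                     ≡⟨ ∑-split (m ℕ.* n) n f ⟩
  ∑ (m ℕ.* n) f + ∑ n (λ r → f (m ℕ.* n ℕ.+ r))           ≡⟨ cong (_+ ∑ n (λ r → f (m ℕ.* n ℕ.+ r))) (∑-blocks m n f) ⟩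
  ∑ m (λ i → ∑ n (λ r → f (i ℕ.* n ℕ.+ r))) + ∑ n (λ r → f (m ℕ.* n ℕ.+ r)) ∎

fromℤ : ℤ → ℚ
fromℤ a = a / 1

fromℕ : ℕ → ℚ
fromℕ n = fromℤ (+ n)

toℚᵘ-fromℤ : ∀ a → toℚᵘ (fromℤ a) ℚᵘ.≃ ℚᵘ.mkℚᵘ a 0
toℚᵘ-fromℤ a = ℚP.toℚᵘ-fromℚᵘ (ℚᵘ.mkℚᵘ a 0)

fromℤ-+ : ∀ a b → fromℤ (a ℤ.+ b) ≡ fromℤ a + fromℤ b
fromℤ-+ a b = ℚP.toℚᵘ-injective (ℚᵘP.≃-trans (toℚᵘ-fromℤ (a ℤ.+ b)) (ℚᵘP.≃-sym
  (ℚᵘP.≃-trans (ℚP.toℚᵘ-homo-+ (fromℤ a) (fromℤ b)) (ℚᵘP.≃-trans (ℚᵘP.+-cong (toℚᵘ-fromℤ a) (toℚᵘ-fromℤ b))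
    (ℚᵘ.*≡* (cong₂ (λ x y → (x ℤ.+ y) ℤ.* + 1) (ℤP.*-identityʳ a) (ℤP.*-identityʳ b)))))))

fromℤ-* : ∀ a b → fromℤ (a ℤ.* b) ≡ fromℤ a * fromℤ b
fromℤ-* a b = ℚP.toℚᵘ-injective (ℚᵘP.≃-trans (toℚᵘ-fromℤ (a ℤ.* b)) (ℚᵘP.≃-sym
  (ℚᵘP.≃-trans (ℚP.toℚᵘ-homo-* (fromℤ a) (fromℤ b)) (ℚᵘP.*-cong (toℚᵘ-fromℤ a) (toℚᵘ-fromℤ b)))))

fromℤ-neg : ∀ a → fromℤ (ℤ.- a) ≡ - fromℤ a
fromℤ-neg a = ℚP.toℚᵘ-injective (ℚᵘP.≃-trans (toℚᵘ-fromℤ (ℤ.- a))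
  (ℚᵘP.≃-sym (ℚᵘP.≃-trans (ℚP.toℚᵘ-homo‿- (fromℤ a)) (ℚᵘP.-‿cong (toℚᵘ-fromℤ a)))))

fromℕ-+ : ∀ m n → fromℕ (m ℕ.+ n) ≡ fromℕ m + fromℕ n
fromℕ-+ m n = trans (cong fromℤ (ℤP.pos-+ m n)) (fromℤ-+ (+ m) (+ n))

fromℕ-* : ∀ m n → fromℕ (m ℕ.* n) ≡ fromℕ m * fromℕ n
fromℕ-* m n = trans (cong fromℤ (ℤP.pos-* m n)) (fromℤ-* (+ m) (+ n))

1/[1+_] : ℕ → ℚ
1/[1+ k ] = + 1 / suc k

1/[1+_]² : ℕ → ℚ
1/[1+ k ]² = 1/[1+ k ] * 1/[1+ k ]

H≡∑ : ∀ n → H n ≡ ∑ n 1/[1+_]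
H≡∑ zero    = refl
H≡∑ (suc n) = cong (_+ 1/[1+ n ]) (H≡∑ n)

1/[1+]-inverse : ∀ k → 1/[1+ k ] * fromℕ (suc k) ≡ 1ℚ
1/[1+]-inverse k = ℚP.toℚᵘ-injective (ℚᵘP.≃-trans (ℚP.toℚᵘ-homo-* 1/[1+ k ] (fromℕ (suc k)))
  (ℚᵘP.≃-trans (ℚᵘP.*-cong (ℚP.toℚᵘ-fromℚᵘ (ℚᵘ.mkℚᵘ (+ 1) k)) (toℚᵘ-fromℤ (+ suc k)))
    (ℚᵘ.*≡* (trans (ℤP.*-identityʳ _) (trans (ℤP.*-identityˡ _)
      (sym (trans (ℤP.*-identityˡ _) (cong +_ (ℕP.*-identityʳ (suc k))))))))))

-1/[1+]-inverse : ∀ k → (- 1/[1+ k ]) * (- fromℕ (suc k)) ≡ 1ℚ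
-1/[1+]-inverse k = trans (solve 2 (λ w B → (:- w) :* (:- B) := w :* B) refl 1/[1+ k ] (fromℕ (suc k))) (1/[1+]-inverse k)

1/[1+]-unique : ∀ {y} k → y * fromℕ (suc k) ≡ 1ℚ → y ≡ 1/[1+ k ]
1/[1+]-unique {y} k y*k+1≡1 = begin
  y                                     ≡⟨ solve 1 (λ y → y := y :* con 1ℚ) refl y ⟩
  y * 1ℚ                                ≡⟨ cong (y *_) (1/[1+]-inverse k) ⟨
  y * (1/[1+ k ] * fromℕ (suc k))       ≡⟨ solve 3 (λ y a b → y :* (a :* b) := (y :* b) :* a) refl y 1/[1+ k ] (fromℕ (suc k)) ⟩
  y * fromℕ (suc k) * 1/[1+ k ]         ≡⟨ cong (_* 1/[1+ k ]) y*k+1≡1 ⟩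
  1ℚ * 1/[1+ k ]                        ≡⟨ solve 1 (λ y → con 1ℚ :* y := y) refl 1/[1+ k ] ⟩
  1/[1+ k ]                             ∎

1/[1+]-halve : ∀ i → fromℕ 2 * 1/[1+ suc (i ℕ.+ i) ] ≡ 1/[1+ i ]
1/[1+]-halve i = 1/[1+]-unique i (begin
  fromℕ 2 * u * fromℕ (suc i)        ≡⟨ solve 3 (λ t u s → t :* u :* s := u :* (t :* s)) refl (fromℕ 2) u (fromℕ (suc i)) ⟩
  u * (fromℕ 2 * fromℕ (suc i))      ≡⟨ cong (u *_) (fromℕ-* 2 (suc i)) ⟨
  u * fromℕ (2 ℕ.* suc i)            ≡⟨ cong (λ n → u * fromℕ (suc n)) (trans (ℕP.+-suc i (i ℕ.+ 0)) (cong (λ m → suc (i ℕ.+ m)) (ℕP.+-identityʳ i))) ⟩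
  u * fromℕ (suc (suc (i ℕ.+ i)))    ≡⟨ 1/[1+]-inverse (suc (i ℕ.+ i)) ⟩
  1ℚ                                 ∎)
  where u = 1/[1+ suc (i ℕ.+ i) ]

-- The ring solver knows no inverses, so the relations u A = w B = 1 are
-- fed in by hand through the two terms that vanish because of them.
reciprocal-sub : ∀ u A w B → u * A ≡ 1ℚ → w * B ≡ 1ℚ → w - u ≡ (A - B) * (u * w)
reciprocal-sub u A w B uA≡1 wB≡1 = begin
  w - u                                                    ≡⟨ solve 4 (λ u A w B → w :- u := (A :- B) :* (u :* w) :+ w :* (con 1ℚ :- u :* A) :- u :* (con 1ℚ :- w :* B)) refl u A w B ⟩
  (A - B) * (u * w) + w * (1ℚ - u * A) - u * (1ℚ - w * B)  ≡⟨ cong₂ (λ x y → (A - B) * (u * w) + w * (1ℚ - x) - u * (1ℚ - y)) uA≡1 wB≡1 ⟩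
  (A - B) * (u * w) + w * (1ℚ - 1ℚ) - u * (1ℚ - 1ℚ)        ≡⟨ solve 3 (λ D u w → D :+ w :* (con 1ℚ :- con 1ℚ) :- u :* (con 1ℚ :- con 1ℚ) := D) refl ((A - B) * (u * w)) u w ⟩
  (A - B) * (u * w)                                        ∎

module Valuation (p : ℕ) (p-prime : Prime p) where

  p∤_ : ℤ → Set
  p∤ b = ¬ (+ p ℤD.∣ b)

  p∤1+ : ∀ {k} → suc k < p → p∤ (+ suc k)
  p∤1+ k+1<p p∣k+1 = ℕP.<⇒≱ k+1<p (ℕD.∣⇒≤ p∣k+1)

  p∤1 : p∤ (+ 1)
  p∤1 = p∤1+ (ℕ.nonTrivial⇒n>1 p {{prime⇒nonTrivial p-prime}})

  p∤⇒≢0 : ∀ {b} → p∤ b → b ≢ + 0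
  p∤⇒≢0 p∤0 refl = p∤0 (p ℕD.∣0)

  p∤-* : ∀ b c → p∤ b → p∤ c → p∤ (b ℤ.* c)
  p∤-* b c p∤b p∤c p∣bc with euclidsLemma ℤ.∣ b ∣ ℤ.∣ c ∣ p-prime (subst (p ℕD.∣_) (ℤP.abs-* b c) p∣bc)
  ... | inj₁ p∣b = p∤b p∣b
  ... | inj₂ p∣c = p∤c p∣c

  -- A record rather than νAtLeast itself, so that x and k can be inferred.
  infix 4 ν[_]≥_
  record ν[_]≥_ (x : ℚ) (k : ℕ) : Set where
    constructor mkν
    field witness : νAtLeast p x k
  open ν[_]≥_ public

  ν-intro : ∀ {x k} a b → p∤ b → x * fromℤ b ≡ fromℕ (p ^ k) * fromℤ a → ν[ x ]≥ k
  ν-intro a b p∤b eq = mkν (a , b , p∤⇒≢0 p∤b , p∤b , eq)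

  ν-fromℤ : ∀ a → ν[ fromℤ a ]≥ 0
  ν-fromℤ a = ν-intro a (+ 1) p∤1 (solve 1 (λ x → x :* con 1ℚ := con 1ℚ :* x) refl (fromℤ a))

  ν-0 : ∀ {k} → ν[ 0ℚ ]≥ k
  ν-0 {k} = ν-intro (+ 0) (+ 1) p∤1 (solve 1 (λ z → con 0ℚ :* con 1ℚ := z :* con 0ℚ) refl (fromℕ (p ^ k)))

  ν-p : ν[ fromℕ p ]≥ 1
  ν-p = ν-intro (+ 1) (+ 1) p∤1 (cong (λ n → fromℕ n * 1ℚ) (sym (ℕP.*-identityʳ p)))

  ν-1/[1+] : ∀ {k} → p∤ (+ suc k) → ν[ 1/[1+ k ] ]≥ 0
  ν-1/[1+] {k} p∤k+1 = ν-intro (+ 1) (+ suc k) p∤k+1 (1/[1+]-inverse k)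

  ν-+ : ∀ {k x y} → ν[ x ]≥ k → ν[ y ]≥ k → ν[ x + y ]≥ k
  ν-+ {k} {x} {y} (mkν (a , b , _ , p∤b , e)) (mkν (c , d , _ , p∤d , f)) =
    ν-intro (a ℤ.* d ℤ.+ c ℤ.* b) (b ℤ.* d) (p∤-* b d p∤b p∤d) (begin
      (x + y) * fromℤ (b ℤ.* d)                             ≡⟨ cong ((x + y) *_) (fromℤ-* b d) ⟩
      (x + y) * (fromℤ b * fromℤ d)                         ≡⟨ solve 4 (λ x y b d → (x :+ y) :* (b :* d) := x :* b :* d :+ y :* d :* b) refl x y (fromℤ b) (fromℤ d) ⟩
      x * fromℤ b * fromℤ d + y * fromℤ d * fromℤ b         ≡⟨ cong₂ (λ s t → s * fromℤ d + t * fromℤ b) e f ⟩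
      P * fromℤ a * fromℤ d + P * fromℤ c * fromℤ b         ≡⟨ solve 5 (λ P a d c b → P :* a :* d :+ P :* c :* b := P :* (a :* d :+ c :* b)) refl P (fromℤ a) (fromℤ d) (fromℤ c) (fromℤ b) ⟩
      P * (fromℤ a * fromℤ d + fromℤ c * fromℤ b)           ≡⟨ cong (P *_) (trans (fromℤ-+ (a ℤ.* d) (c ℤ.* b)) (cong₂ _+_ (fromℤ-* a d) (fromℤ-* c b))) ⟨
      P * fromℤ (a ℤ.* d ℤ.+ c ℤ.* b)                       ∎)
    where P = fromℕ (p ^ k)

  ν-neg : ∀ {k x} → ν[ x ]≥ k → ν[ - x ]≥ k
  ν-neg {k} {x} (mkν (a , b , _ , p∤b , e)) = ν-intro (ℤ.- a) b p∤b (begin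
    (- x) * fromℤ b        ≡⟨ solve 2 (λ x b → (:- x) :* b := :- (x :* b)) refl x (fromℤ b) ⟩
    - (x * fromℤ b)        ≡⟨ cong -_ e ⟩
    - (P * fromℤ a)        ≡⟨ solve 2 (λ P a → :- (P :* a) := P :* (:- a)) refl P (fromℤ a) ⟩
    P * (- fromℤ a)        ≡⟨ cong (P *_) (fromℤ-neg a) ⟨
    P * fromℤ (ℤ.- a)      ∎)
    where P = fromℕ (p ^ k)

  ν-- : ∀ {k x y} → ν[ x ]≥ k → ν[ y ]≥ k → ν[ x - y ]≥ k
  ν-- νx νy = ν-+ νx (ν-neg νy)

  ν-* : ∀ {k j x y} → ν[ x ]≥ k → ν[ y ]≥ j → ν[ x * y ]≥ k ℕ.+ j
  ν-* {k} {j} {x} {y} (mkν (a , b , _ , p∤b , e)) (mkν (c , d , _ , p∤d , f)) =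
    ν-intro (a ℤ.* c) (b ℤ.* d) (p∤-* b d p∤b p∤d) (begin
      x * y * fromℤ (b ℤ.* d)                   ≡⟨ cong (x * y *_) (fromℤ-* b d) ⟩
      x * y * (fromℤ b * fromℤ d)               ≡⟨ solve 4 (λ x y b d → x :* y :* (b :* d) := (x :* b) :* (y :* d)) refl x y (fromℤ b) (fromℤ d) ⟩
      (x * fromℤ b) * (y * fromℤ d)             ≡⟨ cong₂ _*_ e f ⟩
      (Pᵏ * fromℤ a) * (Pʲ * fromℤ c)           ≡⟨ solve 4 (λ P Q a c → (P :* a) :* (Q :* c) := P :* Q :* (a :* c)) refl Pᵏ Pʲ (fromℤ a) (fromℤ c) ⟩
      Pᵏ * Pʲ * (fromℤ a * fromℤ c)             ≡⟨ cong₂ _*_ (trans (cong fromℕ (ℕP.^-distribˡ-+-* p k j)) (fromℕ-* (p ^ k) (p ^ j))) (fromℤ-* a c) ⟨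
      fromℕ (p ^ (k ℕ.+ j)) * fromℤ (a ℤ.* c)   ∎)
    where
    Pᵏ = fromℕ (p ^ k)
    Pʲ = fromℕ (p ^ j)

  ν-pred : ∀ {k x} → ν[ x ]≥ suc k → ν[ x ]≥ k
  ν-pred {k} {x} (mkν (a , b , _ , p∤b , e)) = ν-intro (+ p ℤ.* a) b p∤b (begin
    x * fromℤ b                       ≡⟨ e ⟩
    fromℕ (p ^ suc k) * fromℤ a       ≡⟨ cong (_* fromℤ a) (fromℕ-* p (p ^ k)) ⟩
    fromℕ p * P * fromℤ a             ≡⟨ solve 3 (λ p P a → p :* P :* a := P :* (p :* a)) refl (fromℕ p) P (fromℤ a) ⟩
    P * (fromℕ p * fromℤ a)           ≡⟨ cong (P *_) (fromℤ-* (+ p) a) ⟨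
    P * fromℤ (+ p ℤ.* a)             ∎)
    where P = fromℕ (p ^ k)

  ν-cancel : ∀ {k x} c → p∤ c → ν[ fromℤ c * x ]≥ k → ν[ x ]≥ k
  ν-cancel {k} {x} c p∤c (mkν (a , b , _ , p∤b , e)) = ν-intro a (c ℤ.* b) (p∤-* c b p∤c p∤b) (begin
    x * fromℤ (c ℤ.* b)          ≡⟨ cong (x *_) (fromℤ-* c b) ⟩
    x * (fromℤ c * fromℤ b)      ≡⟨ solve 3 (λ x c b → x :* (c :* b) := c :* x :* b) refl x (fromℤ c) (fromℤ b) ⟩
    fromℤ c * x * fromℤ b        ≡⟨ e ⟩
    fromℕ (p ^ k) * fromℤ a      ∎)

  ν-*-inverse-of-p : ∀ {k x} y → y * fromℕ p ≡ 1ℚ → ν[ x ]≥ suc k → ν[ y * x ]≥ k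
  ν-*-inverse-of-p {k} {x} y yp≡1 (mkν (a , b , _ , p∤b , e)) = ν-intro a b p∤b (begin
    y * x * fromℤ b                   ≡⟨ solve 3 (λ y x b → y :* x :* b := y :* (x :* b)) refl y x (fromℤ b) ⟩
    y * (x * fromℤ b)                 ≡⟨ cong (y *_) (trans e (cong (_* fromℤ a) (fromℕ-* p (p ^ k)))) ⟩
    y * (fromℕ p * P * fromℤ a)       ≡⟨ solve 4 (λ y p P a → y :* (p :* P :* a) := (y :* p) :* (P :* a)) refl y (fromℕ p) P (fromℤ a) ⟩
    y * fromℕ p * (P * fromℤ a)       ≡⟨ cong (_* (P * fromℤ a)) yp≡1 ⟩
    1ℚ * (P * fromℤ a)                ≡⟨ solve 1 (λ x → con 1ℚ :* x := x) refl (P * fromℤ a) ⟩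
    P * fromℤ a                       ∎)
    where P = fromℕ (p ^ k)

  ν-∑ : ∀ {k} n f → (∀ i → i < n → ν[ f i ]≥ k) → ν[ ∑ n f ]≥ k
  ν-∑ zero    f νf = ν-0
  ν-∑ (suc n) f νf = ν-+ (ν-∑ n f (λ i i<n → νf i (ℕP.m<n⇒m<1+n i<n))) (νf n (ℕP.n<1+n n))

  ν-reciprocal-squares : ∀ {j u A w B} → u * A ≡ 1ℚ → w * B ≡ 1ℚ → ν[ u ]≥ 0 → ν[ w ]≥ 0 →
                         ν[ A - B ]≥ j → ν[ w * w - u * u ]≥ j
  ν-reciprocal-squares {j} {u} {A} {w} {B} uA≡1 wB≡1 νu νw νA-B =
    subst (ν[_]≥ j) (sym w²-u²) (ν-* (ν-* (ν-+ νw νu) (ν-* νu νw)) νA-B)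
    where
    w²-u² : w * w - u * u ≡ (w + u) * (u * w) * (A - B)
    w²-u² = begin
      w * w - u * u                 ≡⟨ solve 2 (λ u w → w :* w :- u :* u := (w :+ u) :* (w :- u)) refl u w ⟩
      (w + u) * (w - u)             ≡⟨ cong ((w + u) *_) (reciprocal-sub u A w B uA≡1 wB≡1) ⟩
      (w + u) * ((A - B) * (u * w)) ≡⟨ solve 3 (λ s D t → s :* (D :* t) := s :* t :* D) refl (w + u) (A - B) (u * w) ⟩
      (w + u) * (u * w) * (A - B)   ∎

  -- The second-order expansion 1/A = 1/B - (A - B)/B² + (A - B)²/(A B²).
  ν-reciprocal-expansion : ∀ {j u A w B} → u * A ≡ 1ℚ → w * B ≡ 1ℚ → ν[ u ]≥ 0 → ν[ w ]≥ 0 →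
                           ν[ A - B ]≥ j → ν[ u - w + (A - B) * (w * w) ]≥ j ℕ.+ j
  ν-reciprocal-expansion {j} {u} {A} {w} {B} uA≡1 wB≡1 νu νw νA-B =
    subst (ν[_]≥ j ℕ.+ j) (sym expansion) (ν-* (ν-* νu (ν-* νw νw)) (ν-* νA-B νA-B))
    where
    D = A - B
    expansion : u - w + D * (w * w) ≡ u * (w * w) * (D * D)
    expansion = begin
      u - w + D * (w * w)              ≡⟨ solve 3 (λ u w D → u :- w :+ D :* (w :* w) := D :* w :* w :- (w :- u)) refl u w D ⟩
      D * w * w - (w - u)              ≡⟨ cong (λ z → D * w * w - z) (reciprocal-sub u A w B uA≡1 wB≡1) ⟩
      D * w * w - D * (u * w)          ≡⟨ solve 3 (λ u w D → D :* w :* w :- D :* (u :* w) := D :* w :* (w :- u)) refl u w D ⟩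
      D * w * (w - u)                  ≡⟨ cong (D * w *_) (reciprocal-sub u A w B uA≡1 wB≡1) ⟩
      D * w * (D * (u * w))            ≡⟨ solve 3 (λ u w D → D :* w :* (D :* (u :* w)) := u :* (w :* w) :* (D :* D)) refl u w D ⟩
      u * (w * w) * (D * D)            ∎

module Harmonic (h : ℕ) (p-prime : Prime (suc (h ℕ.+ h))) (p≥5 : 5 ≤ suc (h ℕ.+ h)) where

  p : ℕ
  p = suc (h ℕ.+ h)

  open Valuation p p-prime public

  p⁻¹ : ℚ
  p⁻¹ = 1/[1+ h ℕ.+ h ]

  4≤p-1 : 4 ≤ h ℕ.+ h
  4≤p-1 = ℕ.s≤s⁻¹ p≥5

  p∤1+< : ∀ {r} → r < h ℕ.+ h → p∤ (+ suc r)
  p∤1+< r<p-1 = p∤1+ (s≤s r<p-1)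

  ν-1/[1+]< : ∀ {r} → r < h ℕ.+ h → ν[ 1/[1+ r ] ]≥ 0
  ν-1/[1+]< r<p-1 = ν-1/[1+] (p∤1+< r<p-1)

  pair-summand< : ∀ {k i} → suc k ℕ.+ suc i ≡ p → k < h ℕ.+ h
  pair-summand< {k} {i} k+i≡p = ℕP.≤-trans (ℕP.m≤m+n (suc k) i) (ℕP.≤-reflexive
    (ℕP.suc-injective (trans (sym (ℕP.+-suc (suc k) i)) k+i≡p)))

  pair-sum : ∀ {k i} → suc k ℕ.+ suc i ≡ p → fromℕ (suc k) - (- fromℕ (suc i)) ≡ fromℕ p
  pair-sum {k} {i} k+i≡p = begin
    fromℕ (suc k) - (- fromℕ (suc i))   ≡⟨ solve 2 (λ a b → a :- (:- b) := a :+ b) refl (fromℕ (suc k)) (fromℕ (suc i)) ⟩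
    fromℕ (suc k) + fromℕ (suc i)       ≡⟨ fromℕ-+ (suc k) (suc i) ⟨
    fromℕ (suc k ℕ.+ suc i)             ≡⟨ cong fromℕ k+i≡p ⟩
    fromℕ p                             ∎

  -- Both pair lemmas expand around 1/(-i) rather than 1/i, since k - (-i) = p.
  ν-pair-squares : ∀ {k i} → suc k ℕ.+ suc i ≡ p → ν[ 1/[1+ k ]² - 1/[1+ i ]² ]≥ 1
  ν-pair-squares {k} {i} k+i≡p =
    subst (ν[_]≥ 1) (solve 2 (λ u v → (:- u) :* (:- u) :- v :* v := u :* u :- v :* v) refl 1/[1+ k ] 1/[1+ i ])
      (ν-reciprocal-squares (1/[1+]-inverse i) (-1/[1+]-inverse k)
        (ν-1/[1+]< (pair-summand< i+k≡p)) (ν-neg (ν-1/[1+]< (pair-summand< k+i≡p)))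
        (subst (ν[_]≥ 1) (sym (pair-sum i+k≡p)) ν-p))
    where
    i+k≡p = trans (ℕP.+-comm (suc i) (suc k)) k+i≡p

  ν-pair-reciprocals : ∀ {k i} → suc k ℕ.+ suc i ≡ p →
                       ν[ 1/[1+ k ] + 1/[1+ i ] + fromℕ p * 1/[1+ i ]² ]≥ 2
  ν-pair-reciprocals {k} {i} k+i≡p =
    subst (ν[_]≥ 2) (trans (cong₂ (λ D x → 1/[1+ k ] - (- 1/[1+ i ]) + D * x) (pair-sum k+i≡p) (neg-square 1/[1+ i ]))
                           (solve 3 (λ u v P → u :- (:- v) :+ P :* (v :* v) := u :+ v :+ P :* (v :* v)) refl 1/[1+ k ] 1/[1+ i ] (fromℕ p)))
      (ν-reciprocal-expansion (1/[1+]-inverse k) (-1/[1+]-inverse i)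
        (ν-1/[1+]< (pair-summand< k+i≡p)) (ν-neg (ν-1/[1+]< (pair-summand< i+k≡p)))
        (subst (ν[_]≥ 1) (sym (pair-sum k+i≡p)) ν-p))
    where
    i+k≡p = trans (ℕP.+-comm (suc i) (suc k)) k+i≡p
    neg-square : ∀ v → (- v) * (- v) ≡ v * v
    neg-square = solve 1 (λ v → (:- v) :* (:- v) := v :* v) refl

  p∤2 : p∤ (+ 2)
  p∤2 = p∤1+< (ℕP.≤-trans (s≤s (s≤s z≤n)) 4≤p-1)

  p∤3 : p∤ (+ 3)
  p∤3 = p∤1+< (ℕP.≤-trans (s≤s (s≤s (s≤s z≤n))) 4≤p-1)

  reflection-pair : ∀ {i} → i < h ℕ.+ h → suc (h ℕ.+ h ∸ suc i) ℕ.+ suc i ≡ p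
  reflection-pair i<p-1 = cong suc (ℕP.m∸n+n≡m i<p-1)

  halves-pair : ∀ {i} → i < h → suc (h ℕ.+ (h ∸ suc i)) ℕ.+ suc i ≡ p
  halves-pair {i} i<h = cong suc (trans (ℕP.+-assoc h (h ∸ suc i) (suc i)) (cong (h ℕ.+_) (ℕP.m∸n+n≡m i<h)))

  parity-pair : ∀ {i} → i < h → suc ((h ∸ suc i) ℕ.+ (h ∸ suc i)) ℕ.+ suc (suc (i ℕ.+ i)) ≡ p
  parity-pair {i} i<h = cong suc (begin
    j ℕ.+ j ℕ.+ suc (suc (i ℕ.+ i))      ≡⟨ cong (λ m → j ℕ.+ j ℕ.+ suc m) (ℕP.+-suc i i) ⟨
    j ℕ.+ j ℕ.+ (suc i ℕ.+ suc i)        ≡⟨ +-interchange j j (suc i) (suc i) ⟩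
    (j ℕ.+ suc i) ℕ.+ (j ℕ.+ suc i)      ≡⟨ cong (λ m → m ℕ.+ m) (ℕP.m∸n+n≡m i<h) ⟩
    h ℕ.+ h                              ∎)
    where j = h ∸ suc i

  Q : ℚ
  Q = ∑ (h ℕ.+ h) 1/[1+_]²

  ν[Q]≥1 : ν[ Q ]≥ 1
  ν[Q]≥1 = ν-cancel (+ 3) p∤3 (subst (ν[_]≥ 1) 4[E-O]-[T′-T]≡3Q (ν-- (ν-* (ν-fromℤ (+ 4)) ν[E-O]) ν[T′-T]))
    where
    T  = ∑ h 1/[1+_]²
    T′ = ∑ h (λ i → 1/[1+ h ℕ.+ i ]²)
    E  = ∑ h (λ i → 1/[1+ i ℕ.+ i ]²)
    O  = ∑ h (λ i → 1/[1+ suc (i ℕ.+ i) ]²)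

    ν[T′-T] : ν[ T′ - T ]≥ 1
    ν[T′-T] = subst (ν[_]≥ 1) (begin
        ∑ h (λ i → 1/[1+ h ℕ.+ (h ∸ suc i) ]² - 1/[1+ i ]²)   ≡⟨ ∑-- h _ _ ⟩
        ∑ h (λ i → 1/[1+ h ℕ.+ (h ∸ suc i) ]²) - T            ≡⟨ cong (_- T) (∑-reverse h (λ i → 1/[1+ h ℕ.+ i ]²)) ⟨
        T′ - T                                                 ∎)
      (ν-∑ h _ (λ i i<h → ν-pair-squares (halves-pair i<h)))

    ν[E-O] : ν[ E - O ]≥ 1
    ν[E-O] = subst (ν[_]≥ 1) (begin
        ∑ h (λ i → 1/[1+ (h ∸ suc i) ℕ.+ (h ∸ suc i) ]² - 1/[1+ suc (i ℕ.+ i) ]²) ≡⟨ ∑-- h _ _ ⟩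
        ∑ h (λ i → 1/[1+ (h ∸ suc i) ℕ.+ (h ∸ suc i) ]²) - O                     ≡⟨ cong (_- O) (∑-reverse h (λ i → 1/[1+ i ℕ.+ i ]²)) ⟨
        E - O                                                                    ∎)
      (ν-∑ h _ (λ i i<h → ν-pair-squares (parity-pair i<h)))

    4O≡T : fromℕ 4 * O ≡ T
    4O≡T = trans (sym (∑-* h (fromℕ 4) _)) (∑-cong h (λ i _ →
      trans (solve 1 (λ u → con (fromℕ 4) :* (u :* u) := (con (fromℕ 2) :* u) :* (con (fromℕ 2) :* u)) refl 1/[1+ suc (i ℕ.+ i) ])
            (cong (λ v → v * v) (1/[1+]-halve i))))

    4[E-O]-[T′-T]≡3Q : fromℕ 4 * (E - O) - (T′ - T) ≡ fromℕ 3 * Q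
    4[E-O]-[T′-T]≡3Q = begin
      fromℕ 4 * (E - O) - (T′ - T)                          ≡⟨ cong (λ t → fromℕ 4 * (E - O) - (T′ - t)) 4O≡T ⟨
      fromℕ 4 * (E - O) - (T′ - fromℕ 4 * O)                ≡⟨ solve 3 (λ E O T′ → con (fromℕ 4) :* (E :- O) :- (T′ :- con (fromℕ 4) :* O)
                                                                  := con (fromℕ 3) :* (E :+ O) :- ((con (fromℕ 4) :* O :+ T′) :- (E :+ O))) refl E O T′ ⟩
      fromℕ 3 * (E + O) - ((fromℕ 4 * O + T′) - (E + O))   ≡⟨ cong₂ (λ a b → fromℕ 3 * a - (b - a)) (sym (∑-evenOdd h 1/[1+_]²))
                                                                (trans (cong (_+ T′) 4O≡T) (sym (∑-split h h 1/[1+_]²))) ⟩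
      fromℕ 3 * Q - (Q - Q)                                 ≡⟨ solve 1 (λ Q → con (fromℕ 3) :* Q :- (Q :- Q) := con (fromℕ 3) :* Q) refl Q ⟩
      fromℕ 3 * Q                                           ∎

  ν[H[p-1]]≥2 : ν[ H (h ℕ.+ h) ]≥ 2
  ν[H[p-1]]≥2 = ν-cancel (+ 2) p∤2 (subst (ν[_]≥ 2) S-pQ≡2W
      (ν-- (ν-∑ q _ (λ i i<q → ν-pair-reciprocals (reflection-pair i<q))) (ν-* ν-p ν[Q]≥1)))
    where
    q = h ℕ.+ h
    W = H q
    S = ∑ q (λ i → 1/[1+ q ∸ suc i ] + 1/[1+ i ] + fromℕ p * 1/[1+ i ]²)

    S≡W+W+pQ : S ≡ W + W + fromℕ p * Q
    S≡W+W+pQ = begin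
      S                                                                 ≡⟨ ∑-+ q _ _ ⟩
      ∑ q (λ i → 1/[1+ q ∸ suc i ] + 1/[1+ i ]) + ∑ q (λ i → fromℕ p * 1/[1+ i ]²)
                                                                        ≡⟨ cong₂ _+_ (∑-+ q _ _) (∑-* q (fromℕ p) 1/[1+_]²) ⟩
      ∑ q (λ i → 1/[1+ q ∸ suc i ]) + ∑ q 1/[1+_] + fromℕ p * Q         ≡⟨ cong (λ s → s + ∑ q 1/[1+_] + fromℕ p * Q) (∑-reverse q 1/[1+_]) ⟨
      ∑ q 1/[1+_] + ∑ q 1/[1+_] + fromℕ p * Q                           ≡⟨ cong (λ s → s + s + fromℕ p * Q) (H≡∑ q) ⟨
      W + W + fromℕ p * Q                                               ∎

    S-pQ≡2W : S - fromℕ p * Q ≡ fromℕ 2 * W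
    S-pQ≡2W = trans (cong (_- fromℕ p * Q) S≡W+W+pQ)
      (solve 2 (λ W R → W :+ W :+ R :- R := con (fromℕ 2) :* W) refl W (fromℕ p * Q))

  block : ℕ → ℚ
  block m = ∑ (h ℕ.+ h) (λ r → 1/[1+ m ℕ.* p ℕ.+ r ])

  ν-block-term : ∀ m {r} → r < h ℕ.+ h →
                 ν[ 1/[1+ m ℕ.* p ℕ.+ r ] - 1/[1+ r ] + fromℕ m * fromℕ p * 1/[1+ r ]² ]≥ 2
  ν-block-term m {r} r<p-1 =
    subst (λ D → ν[ 1/[1+ m ℕ.* p ℕ.+ r ] - 1/[1+ r ] + D * 1/[1+ r ]² ]≥ 2) gap
      (ν-reciprocal-expansion (1/[1+]-inverse (m ℕ.* p ℕ.+ r)) (1/[1+]-inverse r)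
        (ν-1/[1+] p∤mp+r+1) (ν-1/[1+]< r<p-1) (subst (ν[_]≥ 1) (sym gap) (ν-* (ν-fromℤ (+ m)) ν-p)))
    where
    gap : fromℕ (suc (m ℕ.* p ℕ.+ r)) - fromℕ (suc r) ≡ fromℕ m * fromℕ p
    gap = begin
      fromℕ (suc (m ℕ.* p ℕ.+ r)) - fromℕ (suc r)       ≡⟨ cong (λ n → fromℕ n - fromℕ (suc r)) (ℕP.+-suc (m ℕ.* p) r) ⟨
      fromℕ (m ℕ.* p ℕ.+ suc r) - fromℕ (suc r)         ≡⟨ cong (_- fromℕ (suc r)) (trans (fromℕ-+ (m ℕ.* p) (suc r)) (cong (_+ fromℕ (suc r)) (fromℕ-* m p))) ⟩
      fromℕ m * fromℕ p + fromℕ (suc r) - fromℕ (suc r) ≡⟨ solve 2 (λ a b → a :+ b :- b := a) refl (fromℕ m * fromℕ p) (fromℕ (suc r)) ⟩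
      fromℕ m * fromℕ p                                 ∎
    p∤mp+r+1 : p∤ (+ suc (m ℕ.* p ℕ.+ r))
    p∤mp+r+1 p∣mp+r+1 = p∤1+< r<p-1 (ℕD.∣m+n∣m⇒∣n (subst (p ℕD.∣_) (sym (ℕP.+-suc (m ℕ.* p) r)) p∣mp+r+1) (ℕD.n∣m*n m))

  ν[block]≥2 : ∀ m → ν[ block m ]≥ 2
  ν[block]≥2 m = subst (ν[_]≥ 2) S+W-MQ≡block
      (ν-- (ν-+ (ν-∑ q _ (λ r r<q → ν-block-term m r<q)) ν[H[p-1]]≥2) (ν-* (ν-* (ν-fromℤ (+ m)) ν-p) ν[Q]≥1))
    where
    q = h ℕ.+ h
    M = fromℕ m * fromℕ p
    S = ∑ q (λ r → 1/[1+ m ℕ.* p ℕ.+ r ] - 1/[1+ r ] + M * 1/[1+ r ]²)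

    S+W-MQ≡block : S + H q - M * Q ≡ block m
    S+W-MQ≡block = begin
      S + H q - M * Q                                       ≡⟨ cong₂ (λ s w → s + w - M * Q) (trans (∑-+ q _ _) (cong₂ _+_ (∑-- q _ _) (∑-* q M 1/[1+_]²))) (H≡∑ q) ⟩
      block m - ∑ q 1/[1+_] + M * Q + ∑ q 1/[1+_] - M * Q   ≡⟨ solve 3 (λ B W R → B :- W :+ R :+ W :- R := B) refl (block m) (∑ q 1/[1+_]) (M * Q) ⟩
      block m                                               ∎

  1/[1+]-block-end : ∀ m → 1/[1+ m ℕ.* p ℕ.+ (h ℕ.+ h) ] ≡ p⁻¹ * 1/[1+ m ]
  1/[1+]-block-end m = sym (1/[1+]-unique (m ℕ.* p ℕ.+ (h ℕ.+ h)) (begin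
    p⁻¹ * 1/[1+ m ] * fromℕ (suc (m ℕ.* p ℕ.+ (h ℕ.+ h)))    ≡⟨ cong (λ n → p⁻¹ * 1/[1+ m ] * fromℕ n) block-end≡p*[1+m] ⟩
    p⁻¹ * 1/[1+ m ] * fromℕ (p ℕ.* suc m)                   ≡⟨ cong (p⁻¹ * 1/[1+ m ] *_) (fromℕ-* p (suc m)) ⟩
    p⁻¹ * 1/[1+ m ] * (fromℕ p * fromℕ (suc m))             ≡⟨ solve 4 (λ a b c d → a :* b :* (c :* d) := (a :* c) :* (b :* d)) refl p⁻¹ 1/[1+ m ] (fromℕ p) (fromℕ (suc m)) ⟩
    (p⁻¹ * fromℕ p) * (1/[1+ m ] * fromℕ (suc m))           ≡⟨ cong₂ _*_ (1/[1+]-inverse (h ℕ.+ h)) (1/[1+]-inverse m) ⟩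
    1ℚ * 1ℚ                                                 ≡⟨⟩
    1ℚ                                                      ∎))
    where
    block-end≡p*[1+m] : suc (m ℕ.* p ℕ.+ (h ℕ.+ h)) ≡ p ℕ.* suc m
    block-end≡p*[1+m] = begin
      suc (m ℕ.* p ℕ.+ (h ℕ.+ h))   ≡⟨ ℕP.+-suc (m ℕ.* p) (h ℕ.+ h) ⟨
      m ℕ.* p ℕ.+ p                 ≡⟨ ℕP.+-comm (m ℕ.* p) p ⟩
      p ℕ.+ m ℕ.* p                 ≡⟨ cong (p ℕ.+_) (ℕP.*-comm m p) ⟩
      p ℕ.+ p ℕ.* m                 ≡⟨ ℕP.*-suc p m ⟨
      p ℕ.* suc m                   ∎

  H-blocks : ∀ n → H (n ℕ.* p) ≡ ∑ n block + p⁻¹ * H n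
  H-blocks n = begin
    H (n ℕ.* p)                                   ≡⟨ H≡∑ (n ℕ.* p) ⟩
    ∑ (n ℕ.* p) 1/[1+_]                           ≡⟨ ∑-blocks n p 1/[1+_] ⟩
    ∑ n (λ m → block m + 1/[1+ m ℕ.* p ℕ.+ (h ℕ.+ h) ]) ≡⟨ ∑-cong n (λ m _ → cong (λ z → block m + z) (1/[1+]-block-end m)) ⟩
    ∑ n (λ m → block m + p⁻¹ * 1/[1+ m ])         ≡⟨ ∑-+ n block _ ⟩
    ∑ n block + ∑ n (λ m → p⁻¹ * 1/[1+ m ])       ≡⟨ cong (λ z → ∑ n block + z) (trans (∑-* n p⁻¹ 1/[1+_]) (cong (p⁻¹ *_) (sym (H≡∑ n)))) ⟩
    ∑ n block + p⁻¹ * H n                         ∎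

  divPrimePow-2 : ∀ x → divPrimePow p p-prime 2 x ≡ x * (p⁻¹ * p⁻¹)
  divPrimePow-2 x = cong (x *_) (sym (1/[1+]-unique (ℕ.pred (p ^ 2)) (begin
    p⁻¹ * p⁻¹ * fromℕ (p ℕ.* (p ℕ.* 1))    ≡⟨ cong (λ n → p⁻¹ * p⁻¹ * fromℕ (p ℕ.* n)) (ℕP.*-identityʳ p) ⟩
    p⁻¹ * p⁻¹ * fromℕ (p ℕ.* p)            ≡⟨ cong (p⁻¹ * p⁻¹ *_) (fromℕ-* p p) ⟩
    p⁻¹ * p⁻¹ * (fromℕ p * fromℕ p)        ≡⟨ solve 2 (λ a b → a :* a :* (b :* b) := (a :* b) :* (a :* b)) refl p⁻¹ (fromℕ p) ⟩
    (p⁻¹ * fromℕ p) * (p⁻¹ * fromℕ p)      ≡⟨ cong (λ y → y * y) (1/[1+]-inverse (h ℕ.+ h)) ⟩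
    1ℚ * 1ℚ                                ≡⟨⟩
    1ℚ                                     ∎)))

  harmonic-congruence : ∀ n → ν[ H (p ^ 2 ℕ.* n) - divPrimePow p p-prime 2 (H n) ]≥ 1
  harmonic-congruence n = subst (ν[_]≥ 1) (sym decomposition)
      (ν-+ (ν-pred (ν-∑ (p ℕ.* n) block (λ m _ → ν[block]≥2 m)))
           (ν-*-inverse-of-p p⁻¹ (1/[1+]-inverse (h ℕ.+ h)) (ν-∑ n block (λ m _ → ν[block]≥2 m))))
    where
    X = ∑ (p ℕ.* n) block
    Y = ∑ n block
    p²n≡pn*p : p ^ 2 ℕ.* n ≡ p ℕ.* n ℕ.* p
    p²n≡pn*p = begin
      p ℕ.* (p ℕ.* 1) ℕ.* n   ≡⟨ cong (λ m → p ℕ.* m ℕ.* n) (ℕP.*-identityʳ p) ⟩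
      p ℕ.* p ℕ.* n           ≡⟨ ℕP.*-assoc p p n ⟩
      p ℕ.* (p ℕ.* n)         ≡⟨ ℕP.*-comm p (p ℕ.* n) ⟩
      p ℕ.* n ℕ.* p           ∎
    decomposition : H (p ^ 2 ℕ.* n) - divPrimePow p p-prime 2 (H n) ≡ X + p⁻¹ * Y
    decomposition = begin
      H (p ^ 2 ℕ.* n) - divPrimePow p p-prime 2 (H n)  ≡⟨ cong₂ (λ m z → H m - z) p²n≡pn*p (divPrimePow-2 (H n)) ⟩
      H (p ℕ.* n ℕ.* p) - H n * (p⁻¹ * p⁻¹)            ≡⟨ cong (_- H n * (p⁻¹ * p⁻¹)) (H-blocks (p ℕ.* n)) ⟩
      X + p⁻¹ * H (p ℕ.* n) - H n * (p⁻¹ * p⁻¹)        ≡⟨ cong (λ z → X + p⁻¹ * z - H n * (p⁻¹ * p⁻¹)) (trans (cong H (ℕP.*-comm p n)) (H-blocks n)) ⟩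
      X + p⁻¹ * (Y + p⁻¹ * H n) - H n * (p⁻¹ * p⁻¹)    ≡⟨ solve 4 (λ X Y i a → X :+ i :* (Y :+ i :* a) :- a :* (i :* i) := X :+ i :* Y) refl X Y p⁻¹ (H n) ⟩
      X + p⁻¹ * Y                                      ∎

even⊎odd : ∀ n → (∃[ h ] n ≡ h ℕ.+ h) ⊎ (∃[ h ] n ≡ suc (h ℕ.+ h))
even⊎odd zero    = inj₁ (0 , refl)
even⊎odd (suc n) with even⊎odd n
... | inj₁ (h , n≡h+h)   = inj₂ (h , cong suc n≡h+h)
... | inj₂ (h , n≡1+h+h) = inj₁ (suc h , cong suc (trans n≡1+h+h (sym (ℕP.+-suc h h))))

prime>2⇒odd : ∀ {p} → Prime p → 2 < p → ∃[ h ] p ≡ suc (h ℕ.+ h)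
prime>2⇒odd {p} p-prime 2<p with even⊎odd p
... | inj₂ p-odd = p-odd
... | inj₁ (h , refl) with prime⇒irreducible p-prime (ℕD.divides h (trans (cong (h ℕ.+_) (sym (ℕP.+-identityʳ h))) (ℕP.*-comm 2 h)))
...   | inj₁ ()
...   | inj₂ 2≡p = contradiction 2≡p (ℕP.<⇒≢ 2<p)

lemma3p6 : (p n : ℕ) → (pp : Prime p) → p ≥ 5 → n ≥ 1 →
    νAtLeast p (H (p ^ 2 ℕ.* n) - divPrimePow p pp 2 (H n)) 1
lemma3p6 p n pp p≥5 _ with prime>2⇒odd pp (ℕP.≤-trans (s≤s (s≤s (s≤s z≤n))) p≥5)
... | h , refl = let open Harmonic h pp p≥5 in witness (harmonic-congruence n)
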